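{- Let $G_1=(V_1,E_1)$ and $G_2=(V_2,E_2)$ be finite simple graphs and let $G_1 \times G_2$ denote their Cartesian product. Then $$M_N(G_1 \times G_2) = 6M_1(G_1)M_1(G_2) + |V_2|\,M_N(G_1) + |V_1|\,M_N(G_2) + 16\big[\,|E_2|\,M_2(G_1) + |E_1|\,M_2(G_2)\big].$$
   Context: For a finite simple graph $G$, $\deg_G(v)$ is the degree of $v$, $N_G(v)$ the set of neighbours of $v$, and $\delta_G(v) = \sum_{u \in N_G(v)} \deg_G(u)$. The first and second Zagreb indices are $M_1(G) = \sum_{u \in V(G)} \deg_G(u)^2$ and $M_2(G) = \sum_{uv \in E(G)} \deg_G(u)\deg_G(v)$. The Neighbourhood Zagreb index is $M_N(G) = \sum_{v \in V(G)} \delta_G(v)^2$. The Cartesian product $G_1 \times G_2$ has vertex set $V_1 \times V_2$, with $(u_1,v_1)$ adjacent to $(u_2,v_2)$ if and only if either $u_1 = u_2$ and $v_1v_2 \in E_2$, or $v_1 = v_2$ and $u_1u_2 \in E_1$. -}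

module Defs where

open import Data.Nat using (ℕ; zero; suc; _+_; _*_; _^_; _<ᵇ_)
open import Data.Bool using (Bool; true; false; if_then_else_; _∧_; _∨_)
open import Data.Fin using (Fin; toℕ; remQuot; _≟_)
open import Data.Product using (_×_; _,_; proj₁; proj₂)
open import Relation.Nullary.Decidable using (⌊_⌋)
open import Relation.Binary.PropositionalEquality using (_≡_)

sumFin : (n : ℕ) → (Fin n → ℕ) → ℕ
sumFin zero    f = 0
sumFin (suc n) f = f Fin.zero + sumFin n (λ i → f (Fin.suc i))

Graph : ℕ → Set
Graph n = Fin n → Fin n → Bool

IsSimple : {n : ℕ} → Graph n → Set
IsSimple {n} g = ((i j : Fin n) → g i j ≡ g j i) × ((i : Fin n) → g i i ≡ false)

ind : Bool → ℕ
ind b = if b then 1 else 0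

deg : {n : ℕ} → Graph n → Fin n → ℕ
deg {n} g v = sumFin n (λ u → ind (g v u))

δ : {n : ℕ} → Graph n → Fin n → ℕ
δ {n} g v = sumFin n (λ u → if g v u then deg g u else 0)

-- Number of edges: unordered pairs {i,j} (counted once via toℕ i < toℕ j).
numEdges : {n : ℕ} → Graph n → ℕ
numEdges {n} g = sumFin n (λ i → sumFin n (λ j → ind (g i j ∧ (toℕ i <ᵇ toℕ j))))

M₁ : {n : ℕ} → Graph n → ℕ
M₁ {n} g = sumFin n (λ v → deg g v ^ 2)

M₂ : {n : ℕ} → Graph n → ℕ
M₂ {n} g = sumFin n (λ i → sumFin n (λ j →
  if g i j ∧ (toℕ i <ᵇ toℕ j) then deg g i * deg g j else 0))

MN : {n : ℕ} → Graph n → ℕ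
MN {n} g = sumFin n (λ v → δ g v ^ 2)

-- Cartesian product; vertex set Fin (m * n) ≅ Fin m × Fin n via remQuot (a bijection).
_□_ : {m n : ℕ} → Graph m → Graph n → Graph (m * n)
_□_ {m} {n} g₁ g₂ x y with remQuot {m} n x | remQuot {m} n y
... | (u₁ , v₁) | (u₂ , v₂) = (⌊ u₁ ≟ u₂ ⌋ ∧ g₂ v₁ v₂) ∨ (⌊ v₁ ≟ v₂ ⌋ ∧ g₁ u₁ u₂)

module Submission where

-- A vertex of G₁ □ G₂ is a pair (u , v); its neighbours are (u , v') with
-- v' ~ v in G₂ and (u' , v) with u' ~ u in G₁.  Hence
--   deg (u , v) = deg₁ u + deg₂ v,
--   δ   (u , v) = δ₁ u + δ₂ v + 2 deg₁ u deg₂ v.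
-- Squaring δ (u , v) and summing over the grid Fin n₁ × Fin n₂, every term of
-- the expansion separates into a product of a sum over G₁ and a sum over G₂:
--   MN (G₁ □ G₂) = n₂ MN₁ + n₁ MN₂ + 4 M₁₁ M₁₂ + 2 (Σδ₁)(Σδ₂)
--                  + 4 (Σδ₁deg₁)(Σdeg₂) + 4 (Σdeg₁)(Σδ₂deg₂).
-- The handshake lemma (each edge is seen from both of its ends) evaluates the
-- remaining single-graph sums: Σ deg = 2|E|, Σ δ = M₁ and Σ δ·deg = 2 M₂.

open import Defs
open import Data.Nat using (ℕ; _+_; _*_)
open import Relation.Binary.PropositionalEquality using (_≡_)

open import Data.Nat using (zero; suc; _^_; _<ᵇ_; _<_)
open import Data.Nat.Properties
  using (+-identityʳ; *-identityʳ; *-zeroʳ; *-comm; +-comm; +-assoc; <-cmp; <ᵇ⇒<; <⇒<ᵇ; +-*-semiring)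
open import Data.Bool using (Bool; true; false; if_then_else_; _∧_; _∨_; T)
open import Data.Bool.Properties using (∧-identityʳ; ∧-zeroʳ)
open import Data.Empty using (⊥-elim)
open import Data.Fin using (Fin; toℕ; combine; _↑ˡ_; _↑ʳ_; _≟_)
open import Data.Fin.Properties using (remQuot-combine; toℕ-injective)
open import Data.Product using (_×_; _,_; proj₁; proj₂)
open import Data.List using (_∷_; [])
open import Relation.Nullary using (¬_; yes; no)
open import Relation.Nullary.Decidable using (⌊_⌋; toWitness)
open import Relation.Binary using (tri<; tri≈; tri>)
open import Relation.Binary.PropositionalEquality
  using (refl; sym; trans; cong; cong₂; subst; module ≡-Reasoning)
open import Algebra.Properties.Semiring.Sum +-*-semiring
  using (sum; sum-cong-≗; ∑-distrib-+; ∑-comm; *-distribˡ-sum; *-distribʳ-sum)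
open import Data.Nat.Tactic.RingSolver using (solve; solve-∀)
open import Data.Nat.Solver using (module +-*-Solver)

open ≡-Reasoning

private variable m n : ℕ

sumFin≡sum : (f : Fin n → ℕ) → sumFin n f ≡ sum f
sumFin≡sum {zero}  f = refl
sumFin≡sum {suc n} f = cong (f Fin.zero +_) (sumFin≡sum (λ i → f (Fin.suc i)))

sum-cong : {f g : Fin n → ℕ} → (∀ i → f i ≡ g i) → sumFin n f ≡ sumFin n g
sum-cong {f = f} {g} f≗g =
  trans (sumFin≡sum f) (trans (sum-cong-≗ f≗g) (sym (sumFin≡sum g)))

sum-+ : (f g : Fin n → ℕ) → sumFin n (λ i → f i + g i) ≡ sumFin n f + sumFin n g
sum-+ f g = trans (sumFin≡sum (λ i → f i + g i))
  (trans (∑-distrib-+ f g) (sym (cong₂ _+_ (sumFin≡sum f) (sumFin≡sum g))))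

sum-*ˡ : (k : ℕ) (f : Fin n → ℕ) → sumFin n (λ i → k * f i) ≡ k * sumFin n f
sum-*ˡ k f = trans (sumFin≡sum (λ i → k * f i))
  (trans (sym (*-distribˡ-sum k f)) (cong (k *_) (sym (sumFin≡sum f))))

sum-*ʳ : (k : ℕ) (f : Fin n → ℕ) → sumFin n (λ i → f i * k) ≡ sumFin n f * k
sum-*ʳ k f = trans (sumFin≡sum (λ i → f i * k))
  (trans (sym (*-distribʳ-sum k f)) (cong (_* k) (sym (sumFin≡sum f))))

sum-swap : (f : Fin m → Fin n → ℕ) →
  sumFin m (λ i → sumFin n (f i)) ≡ sumFin n (λ j → sumFin m (λ i → f i j))
sum-swap {m} {n} f = begin
  sumFin m (λ i → sumFin n (f i))      ≡⟨ sum-cong (λ i → sumFin≡sum (f i)) ⟩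
  sumFin m (λ i → sum (f i))           ≡⟨ sumFin≡sum (λ i → sum (f i)) ⟩
  sum (λ i → sum (f i))                ≡⟨ ∑-comm f ⟩
  sum (λ j → sum (λ i → f i j))        ≡⟨ sumFin≡sum (λ j → sum (λ i → f i j)) ⟨
  sumFin n (λ j → sum (λ i → f i j))   ≡⟨ sum-cong (λ j → sumFin≡sum (λ i → f i j)) ⟨
  sumFin n (λ j → sumFin m (λ i → f i j)) ∎

sum-const : (k : ℕ) → sumFin n (λ _ → k) ≡ n * k
sum-const {zero}  k = refl
sum-const {suc n} k = cong (k +_) (sum-const {n} k)

sum-↑ : (a b : ℕ) (f : Fin (a + b) → ℕ) →
  sumFin (a + b) f ≡ sumFin a (λ i → f (i ↑ˡ b)) + sumFin b (λ j → f (a ↑ʳ j))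
sum-↑ zero    b f = refl
sum-↑ (suc a) b f =
  trans (cong (f Fin.zero +_) (sum-↑ a b (λ i → f (Fin.suc i)))) (sym (+-assoc (f Fin.zero) _ _))

sum-combine : (f : Fin (m * n) → ℕ) →
  sumFin (m * n) f ≡ sumFin m (λ u → sumFin n (λ v → f (combine u v)))
sum-combine {zero}      f = refl
sum-combine {suc m} {n} f = trans (sum-↑ n (m * n) f)
  (cong (sumFin n (λ v → f (v ↑ˡ (m * n))) +_) (sum-combine {m} (λ j → f (n ↑ʳ j))))

-- Conditional summands.  `when b x` is x if b holds and 0 otherwise; the
-- summands of deg, δ, numEdges and M₂ all have this shape.

when : Bool → ℕ → ℕ
when b x = if b then x else 0

sum-when : (b : Bool) (f : Fin n → ℕ) →
  sumFin n (λ i → when b (f i)) ≡ when b (sumFin n f)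
sum-when true  f = refl
sum-when {n} false f = trans (sum-const {n} 0) (*-zeroʳ n)

sum-δᵏ : (u : Fin n) (X : Fin n → ℕ) → sumFin n (λ u' → when ⌊ u ≟ u' ⌋ (X u')) ≡ X u
sum-δᵏ {suc n} Fin.zero    X = trans (cong (X Fin.zero +_) (sum-when {n} false (λ _ → 0))) (+-identityʳ _)
sum-δᵏ {suc n} (Fin.suc u) X =
  trans (sum-cong (λ u' → cong (λ b → when b (X (Fin.suc u'))) (≟-suc u u')))
        (sum-δᵏ u (λ u' → X (Fin.suc u')))
  where
  ≟-suc : (x y : Fin n) → ⌊ Fin.suc x ≟ Fin.suc y ⌋ ≡ ⌊ x ≟ y ⌋
  ≟-suc x y with x ≟ y
  ... | yes _ = refl
  ... | no  _ = refl

when-*ˡ : (b : Bool) (x y : ℕ) → x * when b y ≡ when b (x * y)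
when-*ˡ true  x y = refl
when-*ˡ false x y = *-zeroʳ x

when-+ : (b : Bool) (x y : ℕ) → when b (x + y) ≡ when b x + when b y
when-+ true  x y = refl
when-+ false x y = refl

when-scale : (b : Bool) (x : ℕ) → when b x ≡ x * when b 1
when-scale true  x = sym (*-identityʳ x)
when-scale false x = sym (*-zeroʳ x)

-- Adjacency in a product is a disjunction of two mutually exclusive cases.
when-∨ : (p b q c : Bool) (x : ℕ) → (T p → T q → b ≡ false) →
  when ((p ∧ b) ∨ (q ∧ c)) x ≡ when p (when b x) + when q (when c x)
when-∨ false b     false c     x _ = refl
when-∨ false b     true  c     x _ = refl
when-∨ true  false false c     x _ = refl
when-∨ true  false true  c     x _ = refl
when-∨ true  true  false c     x _ = sym (+-identityʳ x)
when-∨ true  true  true  c     x excl with excl _ _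
... | ()

<ᵇ-true : {i j : ℕ} → i < j → (i <ᵇ j) ≡ true
<ᵇ-true {i} {j} i<j with i <ᵇ j | <⇒<ᵇ i<j
... | true | _ = refl

<ᵇ-false : {i j : ℕ} → ¬ i < j → (i <ᵇ j) ≡ false
<ᵇ-false {i} {j} i≮j with i <ᵇ j | <ᵇ⇒< i j
... | false | _   = refl
... | true  | i<j = ⊥-elim (i≮j (i<j _))

-- The handshake lemma and its consequences.  IsSimple is the conjunction of
-- the two properties below; each lemma assumes only what it uses.

Symmetric : Graph n → Set
Symmetric {n} G = (i j : Fin n) → G i j ≡ G j i

Loopless : Graph n → Set
Loopless {n} G = (i : Fin n) → G i i ≡ false

module Handshake {n : ℕ} (G : Graph n) (sym-G : Symmetric G) where

  Gᵒ : Fin n → Fin n → Bool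
  Gᵒ i j = G i j ∧ (toℕ i <ᵇ toℕ j)

  orient : Loopless G → (X : Fin n → Fin n → ℕ) → (∀ i j → X i j ≡ X j i) →
    (i j : Fin n) → when (G i j) (X i j) ≡ when (Gᵒ i j) (X i j) + when (Gᵒ j i) (X j i)
  orient loopless X sym-X i j with <-cmp (toℕ i) (toℕ j)
  ... | tri< i<j _ j≮i
      rewrite <ᵇ-true i<j | <ᵇ-false j≮i | ∧-identityʳ (G i j) | ∧-zeroʳ (G j i) =
        sym (+-identityʳ _)
  ... | tri> i≮j _ j<i
      rewrite <ᵇ-true j<i | <ᵇ-false i≮j | ∧-identityʳ (G j i) | ∧-zeroʳ (G i j)
            | sym-G j i | sym-X j i = refl
  ... | tri≈ _ i≡j _ with toℕ-injective i≡j
  ...   | refl rewrite loopless i = refl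

  handshake : Loopless G → (X : Fin n → Fin n → ℕ) → (∀ i j → X i j ≡ X j i) →
    sumFin n (λ i → sumFin n (λ j → when (G i j) (X i j))) ≡
    2 * sumFin n (λ i → sumFin n (λ j → when (Gᵒ i j) (X i j)))
  handshake loopless X sym-X = begin
      sumFin n (λ i → sumFin n (λ j → when (G i j) (X i j)))
    ≡⟨ sum-cong {n} (λ i → trans (sum-cong {n} (orient loopless X sym-X i)) (sum-+ {n} _ _)) ⟩
      sumFin n (λ i → E i + sumFin n (λ j → when (Gᵒ j i) (X j i)))
    ≡⟨ sum-+ E _ ⟩
      sumFin n E + sumFin n (λ i → sumFin n (λ j → when (Gᵒ j i) (X j i)))
    ≡⟨ cong (sumFin n E +_) (trans (sum-swap {n} {n} _) (sym (+-identityʳ _))) ⟩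
      2 * sumFin n E
    ∎
    where
    E : Fin n → ℕ
    E i = sumFin n (λ j → when (Gᵒ i j) (X i j))

  Σdeg≡2E : Loopless G → sumFin n (deg G) ≡ 2 * numEdges G
  Σdeg≡2E loopless = handshake loopless (λ _ _ → 1) (λ _ _ → refl)

  Σδdeg≡2M₂ : Loopless G → sumFin n (λ v → δ G v * deg G v) ≡ 2 * M₂ G
  Σδdeg≡2M₂ loopless = begin
      sumFin n (λ u → δ G u * deg G u)
    ≡⟨ sum-cong {n} (λ u → trans (*-comm (δ G u) (deg G u)) (sym (sum-*ˡ {n} (deg G u) _))) ⟩
      sumFin n (λ u → sumFin n (λ u' → deg G u * when (G u u') (deg G u')))
    ≡⟨ sum-cong (λ u → sum-cong (λ u' → when-*ˡ (G u u') (deg G u) (deg G u'))) ⟩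
      sumFin n (λ u → sumFin n (λ u' → when (G u u') (deg G u * deg G u')))
    ≡⟨ handshake loopless (λ i j → deg G i * deg G j) (λ i j → *-comm (deg G i) (deg G j)) ⟩
      2 * M₂ G
    ∎

  -- Σ δ counts deg u once for each neighbour of u, i.e. deg u times.
  Σδ≡M₁ : sumFin n (δ G) ≡ M₁ G
  Σδ≡M₁ = begin
      sumFin n (λ v → sumFin n (λ u → when (G v u) (deg G u)))
    ≡⟨ sum-swap {n} {n} _ ⟩
      sumFin n (λ u → sumFin n (λ v → when (G v u) (deg G u)))
    ≡⟨ sum-cong (λ u → sum-cong (λ v → trans (cong (λ b → when b (deg G u)) (sym-G v u))
                                               (when-scale (G u v) (deg G u)))) ⟩
      sumFin n (λ u → sumFin n (λ v → deg G u * ind (G u v)))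
    ≡⟨ sum-cong {n} (λ u → trans (sum-*ˡ {n} (deg G u) _) (cong (deg G u *_) (sym (*-identityʳ _)))) ⟩
      M₁ G
    ∎

-- Degree and δ of a vertex (u , v) of the Cartesian product.  Only G₂ needs to
-- be loopless, to keep (u , v) from being its own neighbour.

neighbour-sum-shift : (G : Graph n) (d : Fin n → ℕ) (c : ℕ) (w : Fin n) →
  sumFin n (λ w' → when (G w w') (d w' + c)) ≡
  sumFin n (λ w' → when (G w w') (d w')) + c * deg G w
neighbour-sum-shift {n} G d c w = begin
    sumFin n (λ w' → when (G w w') (d w' + c))
  ≡⟨ sum-cong {n} (λ w' → when-+ (G w w') (d w') c) ⟩
    sumFin n (λ w' → when (G w w') (d w') + when (G w w') c)
  ≡⟨ sum-+ (λ w' → when (G w w') (d w')) (λ w' → when (G w w') c) ⟩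
    sumFin n (λ w' → when (G w w') (d w')) + sumFin n (λ w' → when (G w w') c)
  ≡⟨ cong (sumFin n (λ w' → when (G w w') (d w')) +_)
       (trans (sum-cong {n} (λ w' → when-scale (G w w') c)) (sum-*ˡ {n} c _)) ⟩
    sumFin n (λ w' → when (G w w') (d w')) + c * deg G w
  ∎

module Product {m n : ℕ} (G₁ : Graph m) (G₂ : Graph n) (loopless₂ : Loopless G₂) where

  □-adj : (u u' : Fin m) (v v' : Fin n) →
    (G₁ □ G₂) (combine u v) (combine u' v') ≡ (⌊ u ≟ u' ⌋ ∧ G₂ v v') ∨ (⌊ v ≟ v' ⌋ ∧ G₁ u u')
  □-adj u u' v v' = cong₂ adj (remQuot-combine u v) (remQuot-combine u' v')
    where
    adj : Fin m × Fin n → Fin m × Fin n → Bool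
    adj x y = (⌊ proj₁ x ≟ proj₁ y ⌋ ∧ G₂ (proj₂ x) (proj₂ y))
            ∨ (⌊ proj₂ x ≟ proj₂ y ⌋ ∧ G₁ (proj₁ x) (proj₁ y))

  □-neighbour-sum : (u : Fin m) (v : Fin n) (h : Fin m → Fin n → ℕ) →
    sumFin m (λ u' → sumFin n (λ v' →
      when ((G₁ □ G₂) (combine u v) (combine u' v')) (h u' v'))) ≡
    sumFin n (λ v' → when (G₂ v v') (h u v')) + sumFin m (λ u' → when (G₁ u u') (h u' v))
  □-neighbour-sum u v h = begin
      sumFin m (λ u' → sumFin n (λ v' →
        when ((G₁ □ G₂) (combine u v) (combine u' v')) (h u' v')))
    ≡⟨ sum-cong {m} (λ u' → trans (sum-cong {n} (λ v' → split u' v')) (sum-+ {n} _ _)) ⟩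
      sumFin m (λ u' → Along₂ u' + Along₁ u')
    ≡⟨ sum-+ Along₂ Along₁ ⟩
      sumFin m Along₂ + sumFin m Along₁
    ≡⟨ cong₂ _+_
         (trans (sum-cong {m} (λ u' → sum-when {n} ⌊ u ≟ u' ⌋ _)) (sum-δᵏ u _))
         (trans (sum-swap {m} {n} _) (trans (sum-cong {n} (λ v' → sum-when {m} ⌊ v ≟ v' ⌋ _)) (sum-δᵏ v _))) ⟩
      sumFin n (λ v' → when (G₂ v v') (h u v')) + sumFin m (λ u' → when (G₁ u u') (h u' v))
    ∎
    where
    Along₂ Along₁ : Fin m → ℕ
    Along₂ u' = sumFin n (λ v' → when ⌊ u ≟ u' ⌋ (when (G₂ v v') (h u' v')))
    Along₁ u' = sumFin n (λ v' → when ⌊ v ≟ v' ⌋ (when (G₁ u u') (h u' v')))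
    -- (u , v) is not its own neighbour since G₂ has no loops.
    split : (u' : Fin m) (v' : Fin n) →
      when ((G₁ □ G₂) (combine u v) (combine u' v')) (h u' v') ≡
      when ⌊ u ≟ u' ⌋ (when (G₂ v v') (h u' v')) + when ⌊ v ≟ v' ⌋ (when (G₁ u u') (h u' v'))
    split u' v' = trans (cong (λ b → when b (h u' v')) (□-adj u u' v v'))
      (when-∨ ⌊ u ≟ u' ⌋ (G₂ v v') ⌊ v ≟ v' ⌋ (G₁ u u') (h u' v')
        (λ _ v≡v' → subst (λ w → G₂ v w ≡ false) (toWitness v≡v') (loopless₂ v)))

  deg-□ : (u : Fin m) (v : Fin n) → deg (G₁ □ G₂) (combine u v) ≡ deg G₂ v + deg G₁ u
  deg-□ u v = trans (sum-combine {m} {n} _) (□-neighbour-sum u v (λ _ _ → 1))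

  δ-□ : (u : Fin m) (v : Fin n) →
    δ (G₁ □ G₂) (combine u v) ≡ δ G₁ u + δ G₂ v + 2 * (deg G₁ u * deg G₂ v)
  δ-□ u v = begin
      δ (G₁ □ G₂) (combine u v)
    ≡⟨ trans (sum-combine {m} {n} _) (sum-cong {m} (λ u' → sum-cong {n} (λ v' →
         cong (when (((G₁ □ G₂) (combine u v) (combine u' v')))) (deg-□ u' v')))) ⟩
      sumFin m (λ u' → sumFin n (λ v' →
        when ((G₁ □ G₂) (combine u v) (combine u' v')) (deg G₂ v' + deg G₁ u')))
    ≡⟨ □-neighbour-sum u v (λ u' v' → deg G₂ v' + deg G₁ u') ⟩
      sumFin n (λ v' → when (G₂ v v') (deg G₂ v' + deg G₁ u))
        + sumFin m (λ u' → when (G₁ u u') (deg G₂ v + deg G₁ u'))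
    ≡⟨ cong₂ _+_ (neighbour-sum-shift G₂ (deg G₂) (deg G₁ u) v)
         (trans (sum-cong {m} (λ u' → cong (when (G₁ u u')) (+-comm (deg G₂ v) (deg G₁ u'))))
                (neighbour-sum-shift G₁ (deg G₁) (deg G₂ v) u)) ⟩
      (δ G₂ v + deg G₁ u * deg G₂ v) + (δ G₁ u + deg G₂ v * deg G₁ u)
    ≡⟨ regroup (δ G₁ u) (δ G₂ v) (deg G₁ u) (deg G₂ v) ⟩
      δ G₁ u + δ G₂ v + 2 * (deg G₁ u * deg G₂ v)
    ∎
    where
    regroup : ∀ a b c d → (b + c * d) + (a + d * c) ≡ a + b + 2 * (c * d)
    regroup = solve-∀

square-expansion : ∀ x y z w → (x + y + 2 * (z * w)) ^ 2 ≡
  x ^ 2 + y ^ 2 + 4 * (z ^ 2 * w ^ 2) + 2 * (x * y) + 4 * (x * z * w) + 4 * (z * (y * w))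
square-expansion = +-*-Solver.solve 4 (λ x y z w →
    (x :+ y :+ con 2 :* (z :* w)) :^ 2 :=
    x :^ 2 :+ y :^ 2 :+ con 4 :* (z :^ 2 :* w :^ 2) :+ con 2 :* (x :* y)
      :+ con 4 :* (x :* z :* w) :+ con 4 :* (z :* (y :* w))) refl
  where open +-*-Solver using (_:+_; _:*_; _:^_; _:=_; con)

module Grid {m n : ℕ} where

  ΣΣ : (Fin m → Fin n → ℕ) → ℕ
  ΣΣ F = sumFin m (λ u → sumFin n (F u))

  -- Linearity, packaged to combine term-by-term evaluations.
  infixl 6 _⊕_
  _⊕_ : {F G : Fin m → Fin n → ℕ} {x y : ℕ} → ΣΣ F ≡ x → ΣΣ G ≡ y →
    ΣΣ (λ u v → F u v + G u v) ≡ x + y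
  ΣF≡x ⊕ ΣG≡y = trans (trans (sum-cong {m} (λ u → sum-+ {n} _ _)) (sum-+ {m} _ _)) (cong₂ _+_ ΣF≡x ΣG≡y)

  ΣΣ-left : (f : Fin m → ℕ) → ΣΣ (λ u v → f u) ≡ n * sumFin m f
  ΣΣ-left f = trans (sum-cong {m} (λ u → sum-const {n} (f u))) (sum-*ˡ n f)

  ΣΣ-right : (g : Fin n → ℕ) → ΣΣ (λ u v → g v) ≡ m * sumFin n g
  ΣΣ-right g = sum-const {m} (sumFin n g)

  ΣΣ-sep : (k : ℕ) (f : Fin m → ℕ) (g : Fin n → ℕ) →
    ΣΣ (λ u v → k * (f u * g v)) ≡ k * (sumFin m f * sumFin n g)
  ΣΣ-sep k f g = begin
      ΣΣ (λ u v → k * (f u * g v))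
    ≡⟨ sum-cong {m} (λ u → sum-*ˡ {n} k _) ⟩
      sumFin m (λ u → k * sumFin n (λ v → f u * g v))
    ≡⟨ sum-*ˡ {m} k _ ⟩
      k * sumFin m (λ u → sumFin n (λ v → f u * g v))
    ≡⟨ cong (k *_) (trans (sum-cong {m} (λ u → sum-*ˡ (f u) g)) (sum-*ʳ (sumFin n g) f)) ⟩
      k * (sumFin m f * sumFin n g)
    ∎

  grid-square : (a c : Fin m → ℕ) (b e : Fin n → ℕ) →
    ΣΣ (λ u v → (a u + b v + 2 * (c u * e v)) ^ 2) ≡
      n * sumFin m (λ u → a u ^ 2) + m * sumFin n (λ v → b v ^ 2)
      + 4 * (sumFin m (λ u → c u ^ 2) * sumFin n (λ v → e v ^ 2))
      + 2 * (sumFin m a * sumFin n b)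
      + 4 * (sumFin m (λ u → a u * c u) * sumFin n e)
      + 4 * (sumFin m c * sumFin n (λ v → b v * e v))
  grid-square a c b e = trans
    (sum-cong {m} (λ u → sum-cong {n} (λ v → square-expansion (a u) (b v) (c u) (e v))))
    (ΣΣ-left (λ u → a u ^ 2) ⊕ ΣΣ-right (λ v → b v ^ 2)
      ⊕ ΣΣ-sep 4 (λ u → c u ^ 2) (λ v → e v ^ 2) ⊕ ΣΣ-sep 2 a b
      ⊕ ΣΣ-sep 4 (λ u → a u * c u) e ⊕ ΣΣ-sep 4 c (λ v → b v * e v))

MN-□ : (G₁ : Graph m) (G₂ : Graph n) → Loopless G₂ →
  MN (G₁ □ G₂) ≡
    n * MN G₁ + m * MN G₂ + 4 * (M₁ G₁ * M₁ G₂)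
    + 2 * (sumFin m (δ G₁) * sumFin n (δ G₂))
    + 4 * (sumFin m (λ u → δ G₁ u * deg G₁ u) * sumFin n (deg G₂))
    + 4 * (sumFin m (deg G₁) * sumFin n (λ v → δ G₂ v * deg G₂ v))
MN-□ {m} {n} G₁ G₂ loopless₂ = begin
    MN (G₁ □ G₂)
  ≡⟨ sum-combine {m} (λ x → δ (G₁ □ G₂) x ^ 2) ⟩
    ΣΣ (λ u v → δ (G₁ □ G₂) (combine u v) ^ 2)
  ≡⟨ sum-cong {m} (λ u → sum-cong {n} (λ v → cong (_^ 2) (δ-□ u v))) ⟩
    ΣΣ (λ u v → (δ G₁ u + δ G₂ v + 2 * (deg G₁ u * deg G₂ v)) ^ 2)
  ≡⟨ grid-square (δ G₁) (deg G₁) (δ G₂) (deg G₂) ⟩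
    _
  ∎
  where
  open Product G₁ G₂ loopless₂
  open Grid {m} {n}

-- The closing arithmetic, once the handshake identities are substituted.  The
-- ten graph invariants are explicit: they occur only under _*_, where Agda
-- cannot infer them.
assemble : ∀ n₁ n₂ N₁ N₂ A₁ A₂ B₁ B₂ E₁ E₂ {s₁ s₂ p₁ p₂ d₁ d₂ : ℕ} →
  s₁ ≡ A₁ → s₂ ≡ A₂ → p₁ ≡ 2 * B₁ → p₂ ≡ 2 * B₂ → d₁ ≡ 2 * E₁ → d₂ ≡ 2 * E₂ →
  n₂ * N₁ + n₁ * N₂ + 4 * (A₁ * A₂) + 2 * (s₁ * s₂) + 4 * (p₁ * d₂) + 4 * (d₁ * p₂) ≡
  6 * A₁ * A₂ + n₂ * N₁ + n₁ * N₂ + 16 * (E₂ * B₁ + E₁ * B₂)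
assemble n₁ n₂ N₁ N₂ A₁ A₂ B₁ B₂ E₁ E₂ refl refl refl refl refl refl =
  solve (n₁ ∷ n₂ ∷ N₁ ∷ N₂ ∷ A₁ ∷ A₂ ∷ B₁ ∷ B₂ ∷ E₁ ∷ E₂ ∷ [])

proposition1 : (n₁ n₂ : ℕ) (G₁ : Graph n₁) (G₂ : Graph n₂) →
    IsSimple G₁ → IsSimple G₂ →
    MN (G₁ □ G₂) ≡
      6 * M₁ G₁ * M₁ G₂ + n₂ * MN G₁ + n₁ * MN G₂
        + 16 * (numEdges G₂ * M₂ G₁ + numEdges G₁ * M₂ G₂)
proposition1 n₁ n₂ G₁ G₂ (sym₁ , loopless₁) (sym₂ , loopless₂) =
  trans (MN-□ G₁ G₂ loopless₂)
    (assemble n₁ n₂ (MN G₁) (MN G₂) (M₁ G₁) (M₁ G₂) (M₂ G₁) (M₂ G₂) (numEdges G₁) (numEdges G₂)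
              (Σδ≡M₁ G₁ sym₁) (Σδ≡M₁ G₂ sym₂)
              (Σδdeg≡2M₂ G₁ sym₁ loopless₁) (Σδdeg≡2M₂ G₂ sym₂ loopless₂)
              (Σdeg≡2E G₁ sym₁ loopless₁) (Σdeg≡2E G₂ sym₂ loopless₂))
  where open Handshake
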